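{- For each $N\in\{13,29\}$ and every nonempty finite word $u\in\{0,1\}^*$, $D(\textsc{SInv}_{F_N,u,n})\in O(1)$ as $n\to\infty$.
   Context: The ECA with Wolfram number $N$ is $F_N:\{0,1\}^{\mathbb{Z}}\to\{0,1\}^{\mathbb{Z}}$, $(F_N(x))_i=f_N(x_{i-1},x_i,x_{i+1})$, where $f_N(a,b,c)$ is the bit of index $4a+2b+c$ of $N$ in binary. For a nonempty word $u$, $p_u\in\{0,1\}^{\mathbb{Z}}$ is $(p_u)_i=u_{i\bmod |u|}$; for a finite word $x$, $p_u[x]$ equals $x$ on positions $\{0,\dots,|x|-1\}$ and $p_u$ elsewhere. $\textsc{SInv}_{F,u,n}:\{0,1\}^n\to\{0,1\}$ maps $x$ to $1$ iff there is an integer $w$ such that for every $t\ge 0$ the set of positions where $F^t(p_u)$ and $F^t(p_u[x])$ differ is contained in an interval of length $w$. For finite sets $X,Y,Z$ and $g:X\times Y\to Z$, $D(g)$ is the minimal depth of a deterministic two-party communication protocol tree computing $g$ (Alice knows $x$, Bob knows $y$; internal nodes are labelled by a function of $x$ alone or of $y$ alone to $\{\mathrm{l},\mathrm{r}\}$, leaves by outputs). For $g:\{0,1\}^m\to Z$, $D(g)=\max_{0\le i\le m} D(g_i)$ with $g_i(x,y)=g(xy)$ for $x\in\{0,1\}^i$, $y\in\{0,1\}^{m-i}$. -}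

module Defs where

open import Data.Bool using (Bool; true; false; if_then_else_)
open import Data.Nat as ℕ using (ℕ; zero; suc; _+_; _<?_)
open import Data.Nat.DivMod using (_%_; _/_)
open import Data.Integer as ℤ using (ℤ; +_; -[1+_])
open import Data.Integer.DivMod using (_%ℕ_; n%ℕd<d)
open import Data.Fin using (Fin; fromℕ<)
open import Data.Vec using (Vec; lookup; _++_)
open import Data.Product using (Σ; ∃; _×_)
open import Relation.Nullary using (¬_; yes; no)
open import Relation.Binary.PropositionalEquality using (_≡_)

Config : Set
Config = ℤ → Bool

bit : ℕ → ℕ → Bool
bit N zero    = N % 2 ℕ.≡ᵇ 1
bit N (suc k) = bit (N / 2) k

b2n : Bool → ℕ
b2n true  = 1
b2n false = 0

localRule : ℕ → Bool → Bool → Bool → Bool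
localRule N a b c = bit N (4 ℕ.* b2n a + 2 ℕ.* b2n b + b2n c)

F : ℕ → Config → Config
F N x i = localRule N (x (i ℤ.- ℤ.1ℤ)) (x i) (x (i ℤ.+ ℤ.1ℤ))

iter : (Config → Config) → ℕ → Config → Config
iter G zero    x = x
iter G (suc t) x = G (iter G t x)

per : ∀ {k} → Vec Bool (suc k) → Config
per {k} u i = lookup u (fromℕ< (n%ℕd<d i (suc k)))

patch : ∀ {k n} → Vec Bool (suc k) → Vec Bool n → Config
patch {n = n} u x (+ m) with m <? n
... | yes m<n = lookup x (fromℕ< m<n)
... | no  _   = per u (+ m)
patch u x -[1+ m ] = per u -[1+ m ]

SInv : ∀ {k n} → ℕ → Vec Bool (suc k) → Vec Bool n → Set
SInv N u x =
  ∃ λ (w : ℕ) → ∀ (t : ℕ) → ∃ λ (a : ℤ) → ∀ (i : ℤ) →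
    ¬ (iter (F N) t (per u) i ≡ iter (F N) t (patch u x) i) →
    (a ℤ.≤ i) × (i ℤ.< a ℤ.+ + w)

data Protocol (X Y : Set) : Set where
  leaf  : Bool → Protocol X Y
  alice : (X → Bool) → Protocol X Y → Protocol X Y → Protocol X Y
  bob   : (Y → Bool) → Protocol X Y → Protocol X Y → Protocol X Y

depth : ∀ {X Y} → Protocol X Y → ℕ
depth (leaf _)      = 0
depth (alice _ l r) = suc (depth l ℕ.⊔ depth r)
depth (bob _ l r)   = suc (depth l ℕ.⊔ depth r)

run : ∀ {X Y} → Protocol X Y → X → Y → Bool
run (leaf b)      x y = b
run (alice f l r) x y = if f x then run r x y else run l x y
run (bob g l r)   x y = if g y then run r x y else run l x y

Computes : ∀ {X Y} → Protocol X Y → (X → Y → Set) → Set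
Computes P Q = ∀ x y → ((run P x y ≡ true → Q x y) × (Q x y → run P x y ≡ true))

SplitDepth≤ : ∀ {k} → ℕ → Vec Bool (suc k) → ℕ → ℕ → ℕ → Set
SplitDepth≤ N u i j c =
  ∃ λ (P : Protocol (Vec Bool i) (Vec Bool j)) →
    (depth P ℕ.≤ c) × Computes P (λ x y → SInv N u (x ++ y))

-- Rule 29 satisfies F³ = F, so every perturbation stops spreading after two steps.
-- For rule 13 the pattern 01 is a wall: it never changes, and information cannot cross
-- it in either direction.  If u is not constant, p_u has walls on both sides of any
-- patch, so SInv is identically true.  If u is the constant word c, the background
-- alternates c, ¬c, c, ...; the rightmost difference then moves one cell to the right
-- at every step, and as soon as the background is 1 it leaves a wall behind, so the
-- perturbation grows without bound unless the patch is itself constantly c.  So SInv is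
-- either constantly true or the conjunction of "Alice's half is constantly c" and "Bob's
-- half is constantly c", which a protocol of depth 2 decides for every n.
module Submission where

open import Defs
open import Data.Bool using (Bool; true; false; not; _≟_)
open import Data.Bool.Properties using (not-¬; ¬-not; not-injective; not-involutive)
open import Data.Fin using (Fin; toℕ; fromℕ<)
open import Data.Fin.Properties using (toℕ<n; fromℕ<-cong; fromℕ<-toℕ; all?; ¬∀⟶∃¬)
open import Data.Integer as ℤ using (ℤ; +_; -[1+_]; _+_; _-_; _≤_; _<_; +≤+; -≤-; +<+; 0ℤ; 1ℤ; -1ℤ; ∣_∣; _%ℕ_)
import Data.Integer.Properties as ℤP
open import Data.Integer.Tactic.RingSolver using (solve-∀)
open import Data.Nat as ℕ using (ℕ; zero; suc; z≤n; s≤s)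
open import Data.Nat.DivMod using ([m+n]%n≡m%n; [m+kn]%n≡m%n; m<n⇒m%n≡m; n%n≡0)
import Data.Nat.Properties as ℕP
open import Data.Integer.DivMod using (n%ℕd<d)
open import Data.Product using (∃; _×_; _,_; proj₁; proj₂)
open import Data.Sum using (_⊎_; inj₁; inj₂)
open import Data.Vec using (Vec; lookup; _++_)
open import Data.Vec.Relation.Unary.All using (All) renaming (all? to All?)
open import Data.Vec.Relation.Unary.All.Properties using (lookup⁺; lookup⁻; ++⁺; ++⁻)
open import Function using (_⇔_; mk⇔; Equivalence)
open import Relation.Binary.PropositionalEquality
open import Relation.Nullary using (¬_; Dec; yes; no; does; contradiction)
open import Relation.Nullary.Decidable using (map′; _×-dec_; from-yes)
open import Relation.Unary using (Decidable)

i-1+1≡i : ∀ i → i - 1ℤ + 1ℤ ≡ i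
i-1+1≡i = solve-∀

i+1-1≡i : ∀ i → i + 1ℤ - 1ℤ ≡ i
i+1-1≡i = solve-∀

i-1≤i : ∀ i → i - 1ℤ ≤ i
i-1≤i i = ℤP.i-j≤i i 1ℤ

i≤i+1 : ∀ i → i ≤ i + 1ℤ
i≤i+1 i = ℤP.i≤i+j i 1ℤ

i<i+1 : ∀ i → i < i + 1ℤ
i<i+1 i = ℤP.suc[i]≤j⇒i<j (ℤP.≤-reflexive (ℤP.+-comm 1ℤ i))

≤-1⇒+1≤ : ∀ {i j} → i ≤ j - 1ℤ → i + 1ℤ ≤ j
≤-1⇒+1≤ {j = j} p = subst (_ ≤_) (i-1+1≡i j) (ℤP.+-monoˡ-≤ 1ℤ p)

+1≤⇒≤-1 : ∀ {i j} → i + 1ℤ ≤ j → i ≤ j - 1ℤ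
+1≤⇒≤-1 {i} p = subst (_≤ _) (i+1-1≡i i) (ℤP.+-monoˡ-≤ -1ℤ p)

<⇒+1≤ : ∀ {i j} → i < j → i + 1ℤ ≤ j
<⇒+1≤ {i} p = subst (_≤ _) (ℤP.+-comm 1ℤ i) (ℤP.i<j⇒suc[i]≤j p)

+1≤⇒< : ∀ {i j} → i + 1ℤ ≤ j → i < j
+1≤⇒< {i} p = ℤP.suc[i]≤j⇒i<j (subst (_≤ _) (ℤP.+-comm i 1ℤ) p)

≤⇒≡⊎< : ∀ {i j} → i ≤ j → i ≡ j ⊎ i < j
≤⇒≡⊎< {i} {j} p with i ℤ.≟ j
... | yes i≡j = inj₁ i≡j
... | no i≢j = inj₂ (ℤP.≤∧≢⇒< p i≢j)

i+[j-i]≡j : ∀ i j → i + (j - i) ≡ j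
i+[j-i]≡j = solve-∀

i+s+1≡i+[1+s] : ∀ i s → i + + s + 1ℤ ≡ i + + suc s
i+s+1≡i+[1+s] i s = trans (ℤP.+-assoc i (+ s) 1ℤ) (cong (λ x → i + + x) (ℕP.+-comm s 1))

differ-at : ∀ {x y b} → x ≡ b → y ≡ not b → ¬ x ≡ y
differ-at x≡b y≡¬b x≡y = not-¬ refl (trans (sym x≡b) (trans x≡y y≡¬b))

∀-Bool? : {P : Bool → Set} → Decidable P → Dec (∀ b → P b)
∀-Bool? P? = map′ (λ { (pf , pt) false → pf ; (pf , pt) true → pt }) (λ h → h false , h true) (P? false ×-dec P? true)

rising-edge : (f : ℕ → Bool) → ∀ {a b} → a ℕ.≤ b → f a ≡ false → f b ≡ true →
  ∃ λ j → a ℕ.≤ j × f j ≡ false × f (suc j) ≡ true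
rising-edge f {b = zero} z≤n fa fb = contradiction (trans (sym fa) fb) λ ()
rising-edge f {b = suc b} a≤b+1 fa fb with ℕP.m≤n⇒m<n∨m≡n a≤b+1
... | inj₂ refl = contradiction (trans (sym fa) fb) λ ()
... | inj₁ (s≤s a≤b) with f b in fb′
...   | false = b , a≤b , fb′ , fb
...   | true = rising-edge f a≤b fa fb′

greatest : ∀ {P : ℕ → Set} → Decidable P → ∀ B {p} → P p → (∀ x → B ℕ.≤ x → ¬ P x) →
  ∃ λ m → P m × ∀ x → m ℕ.< x → ¬ P x
greatest P? zero Pp none = contradiction Pp (none _ z≤n)
greatest {P} P? (suc B) Pp none with P? B
... | yes PB = B , PB , none
... | no ¬PB = greatest P? B Pp λ x B≤x → none′ x (ℕP.m≤n⇒m<n∨m≡n B≤x)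
  where
  none′ : ∀ x → B ℕ.< x ⊎ B ≡ x → ¬ P x
  none′ x (inj₁ B<x) = none x B<x
  none′ x (inj₂ refl) = ¬PB

localRule-cong : ∀ N {a a′ b b′ c c′} → a ≡ a′ → b ≡ b′ → c ≡ c′ → localRule N a b c ≡ localRule N a′ b′ c′
localRule-cong N refl refl refl = refl

F-at-pred : ∀ N z i → F N z (i - 1ℤ) ≡ localRule N (z (i - 1ℤ - 1ℤ)) (z (i - 1ℤ)) (z i)
F-at-pred N z i = cong (λ j → localRule N (z (i - 1ℤ - 1ℤ)) (z (i - 1ℤ)) (z j)) (i-1+1≡i i)

F-at-suc : ∀ N z i → F N z (i + 1ℤ) ≡ localRule N (z i) (z (i + 1ℤ)) (z (i + 1ℤ + 1ℤ))
F-at-suc N z i = cong (λ j → localRule N (z j) (z (i + 1ℤ)) (z (i + 1ℤ + 1ℤ))) (i+1-1≡i i)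

iter-cong : ∀ N t {z z′ : Config} → (∀ i → z i ≡ z′ i) → ∀ i → iter (F N) t z i ≡ iter (F N) t z′ i
iter-cong N zero z≗z′ = z≗z′
iter-cong N (suc t) z≗z′ i =
  localRule-cong N (iter-cong N t z≗z′ (i - 1ℤ)) (iter-cong N t z≗z′ i) (iter-cong N t z≗z′ (i + 1ℤ))

iter-+ : ∀ (G : Config → Config) s t z → iter G (s ℕ.+ t) z ≡ iter G s (iter G t z)
iter-+ G zero t z = refl
iter-+ G (suc s) t z = cong G (iter-+ G s t z)

-- Perturbations confined to a window

AgreeUpTo : Config → Config → ℤ → Set
AgreeUpTo z z′ A = ∀ i → i ≤ A → z i ≡ z′ i

AgreeFrom : Config → Config → ℤ → Set
AgreeFrom z z′ B = ∀ i → B ≤ i → z i ≡ z′ i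

AgreeOutside : Config → Config → ℤ → ℤ → Set
AgreeOutside z z′ A B = AgreeUpTo z z′ A × AgreeFrom z z′ B

agreeOutside-mono : ∀ {z z′ A A′ B B′} → A′ ≤ A → B ≤ B′ → AgreeOutside z z′ A B → AgreeOutside z z′ A′ B′
agreeOutside-mono A′≤A B≤B′ (up , from) =
  (λ i i≤A′ → up i (ℤP.≤-trans i≤A′ A′≤A)) , (λ i B′≤i → from i (ℤP.≤-trans B≤B′ B′≤i))

agreeOutside-resp : ∀ {z z′ y y′ A B} → (∀ i → z i ≡ y i) → (∀ i → z′ i ≡ y′ i) →
  AgreeOutside z z′ A B → AgreeOutside y y′ A B
agreeOutside-resp z≗y z′≗y′ (up , from) =
  (λ i i≤A → trans (sym (z≗y i)) (trans (up i i≤A) (z′≗y′ i))) ,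
  (λ i B≤i → trans (sym (z≗y i)) (trans (from i B≤i) (z′≗y′ i)))

F-agreeOutside : ∀ N {z z′ A B} → AgreeOutside z z′ A B → AgreeOutside (F N z) (F N z′) (A - 1ℤ) (B + 1ℤ)
F-agreeOutside N {z} {z′} {A} {B} (up , from) = up′ , from′
  where
  up′ : AgreeUpTo (F N z) (F N z′) (A - 1ℤ)
  up′ i i≤A-1 = localRule-cong N (up (i - 1ℤ) (ℤP.≤-trans (i-1≤i i) i≤A)) (up i i≤A) (up (i + 1ℤ) (≤-1⇒+1≤ i≤A-1))
    where i≤A = ℤP.≤-trans i≤A-1 (i-1≤i A)
  from′ : AgreeFrom (F N z) (F N z′) (B + 1ℤ)
  from′ i B+1≤i =
    localRule-cong N (from (i - 1ℤ) (+1≤⇒≤-1 B+1≤i)) (from i B≤i) (from (i + 1ℤ) (ℤP.≤-trans B≤i (i≤i+1 i)))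
    where B≤i = ℤP.≤-trans (i≤i+1 B) B+1≤i

Spread : Config → Config → ℕ → Set
Spread z z′ w = ∃ λ d → ∃ λ e → ¬ z d ≡ z′ d × ¬ z e ≡ z′ e × d + + w ≤ e

module _ {k n : ℕ} (u : Vec Bool (suc k)) (v : Vec Bool n) where

  patch-out : ∀ m → n ℕ.≤ m → patch u v (+ m) ≡ per u (+ m)
  patch-out m n≤m with m ℕ.<? n
  ... | yes m<n = contradiction n≤m (ℕP.<⇒≱ m<n)
  ... | no _ = refl

  patch-in : ∀ r → patch u v (+ toℕ r) ≡ lookup v r
  patch-in r with toℕ r ℕ.<? n
  ... | yes r<n = cong (lookup v) (fromℕ<-toℕ r r<n)
  ... | no r≮n = contradiction (toℕ<n r) r≮n

  patch-agreeOutside : AgreeOutside (per u) (patch u v) -1ℤ (+ n)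
  patch-agreeOutside = up , from
    where
    up : AgreeUpTo (per u) (patch u v) -1ℤ
    up -[1+ _ ] _ = refl
    from : AgreeFrom (per u) (patch u v) (+ n)
    from (+ m) (+≤+ n≤m) = sym (patch-out m n≤m)

  patch-constant : ∀ {b} → (∀ i → per u i ≡ b) → All (_≡ b) v → ∀ i → per u i ≡ patch u v i
  patch-constant per≡b v≡b (+ m) with m ℕ.<? n
  ... | yes m<n = trans (per≡b (+ m)) (sym (lookup⁺ v≡b (fromℕ< m<n)))
  ... | no _ = refl
  patch-constant per≡b v≡b -[1+ _ ] = refl

  module _ (N : ℕ) where

    -- The window [A, A + ∣A - B∣) contains every position strictly between A and B.
    SInv-intro : ∀ A B → (∀ t → AgreeOutside (iter (F N) t (per u)) (iter (F N) t (patch u v)) A B) → SInv N u v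
    SInv-intro A B agree = ∣ A - B ∣ , λ t → A , λ i differ → box t i differ
      where
      box : ∀ t i → ¬ iter (F N) t (per u) i ≡ iter (F N) t (patch u v) i → A ≤ i × i < A + + ∣ A - B ∣
      box t i differ with i ℤ.≤? A | B ℤ.≤? i
      ... | yes i≤A | _ = contradiction (proj₁ (agree t) i i≤A) differ
      ... | _ | yes B≤i = contradiction (proj₂ (agree t) i B≤i) differ
      ... | no i≰A | no B≰i = ℤP.<⇒≤ A<i , subst (i <_) B≡A+∣A-B∣ i<B
        where
        A<i = ℤP.≰⇒> i≰A
        i<B = ℤP.≰⇒> B≰i
        B≡A+∣A-B∣ : B ≡ A + + ∣ A - B ∣
        B≡A+∣A-B∣ =
          trans (sym (i+[j-i]≡j A B)) (cong (λ x → A + x) (sym (ℤP.∣-∣-≤ (ℤP.<⇒≤ (ℤP.<-trans A<i i<B)))))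

    ¬SInv-intro : (∀ w → ∃ λ t → Spread (iter (F N) t (per u)) (iter (F N) t (patch u v)) w) → ¬ SInv N u v
    ¬SInv-intro spread (w , box) with spread w
    ... | t , d , e , differ-d , differ-e , d+w≤e with box t
    ...   | a , inside with inside d differ-d | inside e differ-e
    ...     | a≤d , _ | _ , e<a+w = ℤP.≤⇒≯ (ℤP.≤-trans (ℤP.+-monoˡ-≤ (+ w) a≤d) d+w≤e) e<a+w

    SInv-unperturbed : (∀ i → per u i ≡ patch u v i) → SInv N u v
    SInv-unperturbed per≗patch =
      SInv-intro 0ℤ 0ℤ λ t → (λ i _ → iter-cong N t per≗patch i) , (λ i _ → iter-cong N t per≗patch i)

    SInv-of-cube : (∀ z i → F N (F N (F N z)) i ≡ F N z i) → SInv N u v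
    SInv-of-cube cube = SInv-intro -[1+ 2 ] (+ n + 1ℤ + 1ℤ) window
      where
      window : ∀ t → AgreeOutside (iter (F N) t (per u)) (iter (F N) t (patch u v)) -[1+ 2 ] (+ n + 1ℤ + 1ℤ)
      window zero = agreeOutside-mono (-≤- z≤n) (ℤP.≤-trans (i≤i+1 _) (i≤i+1 _)) patch-agreeOutside
      window (suc zero) = agreeOutside-mono (-≤- (s≤s z≤n)) (i≤i+1 _) (F-agreeOutside N patch-agreeOutside)
      window (suc (suc zero)) = F-agreeOutside N (F-agreeOutside N patch-agreeOutside)
      window (suc (suc (suc t))) =
        agreeOutside-resp (λ i → sym (cube (iter (F N) t (per u)) i)) (λ i → sym (cube (iter (F N) t (patch u v)) i))
          (window (suc t))

module _ {k : ℕ} (u : Vec Bool (suc k)) where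

  per-cong : ∀ i j → i %ℕ suc k ≡ j %ℕ suc k → per u i ≡ per u j
  per-cong i j e = cong (lookup u) (fromℕ<-cong _ _ e (n%ℕd<d i (suc k)) (n%ℕd<d j (suc k)))

  per-lookup : ∀ i r → i %ℕ suc k ≡ toℕ r → per u i ≡ lookup u r
  per-lookup i r e = cong (lookup u) (trans (fromℕ<-cong _ _ e (n%ℕd<d i (suc k)) (toℕ<n r)) (fromℕ<-toℕ r _))

  per-+* : ∀ r q → per u (+ (toℕ r ℕ.+ q ℕ.* suc k)) ≡ lookup u r
  per-+* r q =
    per-lookup (+ (toℕ r ℕ.+ q ℕ.* suc k)) r (trans ([m+kn]%n≡m%n (toℕ r) q (suc k)) (m<n⇒m%n≡m (toℕ<n r)))

  per-neg-periodic : ∀ x → per u -[1+ x ℕ.+ suc k ] ≡ per u -[1+ x ]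
  per-neg-periodic x = per-cong -[1+ x ℕ.+ suc k ] -[1+ x ] e
    where
    e : -[1+ x ℕ.+ suc k ] %ℕ suc k ≡ -[1+ x ] %ℕ suc k
    e rewrite [m+n]%n≡m%n (suc x) (suc k) ⦃ _ ⦄ = refl

  per-neg-onto : ∀ r → ∃ λ x → x ℕ.< suc k × per u -[1+ x ] ≡ lookup u r
  per-neg-onto r = x , s≤s (ℕP.m∸n≤m k (toℕ r)) , per-lookup -[1+ x ] r (e (toℕ r) (ℕ.s≤s⁻¹ (toℕ<n r)))
    where
    x = k ℕ.∸ toℕ r
    -- -[1+ y ] %ℕ d is d ∸ (suc y % d), except that it is 0 when d divides suc y.
    e : ∀ s → s ℕ.≤ k → -[1+ k ℕ.∸ s ] %ℕ suc k ≡ s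
    e zero _ rewrite n%n≡0 (suc k) ⦃ _ ⦄ = refl
    e (suc s) s<k rewrite m<n⇒m%n≡m {n = suc k} ⦃ _ ⦄ (s≤s (ℕP.∸-monoʳ-< {k} {suc s} {0} (s≤s z≤n) s<k)) =
      ℕP.m∸[m∸n]≡n s<k

-- Rule 29

rule29-cube : ∀ a b c d e f g → let L = localRule 29 in
  L (L (L a b c) (L b c d) (L c d e)) (L (L b c d) (L c d e) (L d e f)) (L (L c d e) (L d e f) (L e f g)) ≡ L c d e
rule29-cube = from-yes (∀-Bool? λ a → ∀-Bool? λ b → ∀-Bool? λ c → ∀-Bool? λ d →
  ∀-Bool? λ e → ∀-Bool? λ f → ∀-Bool? λ g → let L = localRule 29 in
  L (L (L a b c) (L b c d) (L c d e)) (L (L b c d) (L c d e) (L d e f)) (L (L c d e) (L d e f) (L e f g)) ≟ L c d e)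

F29-cube : ∀ z i → F 29 (F 29 (F 29 z)) i ≡ F 29 z i
F29-cube z i = trans (localRule-cong 29 y₋₁ y₀ y₁)
  (rule29-cube (z (i - 1ℤ - 1ℤ - 1ℤ)) (z (i - 1ℤ - 1ℤ)) (z (i - 1ℤ)) (z i)
               (z (i + 1ℤ)) (z (i + 1ℤ + 1ℤ)) (z (i + 1ℤ + 1ℤ + 1ℤ)))
  where
  Fz = F 29 z
  x₋₂ = F-at-pred 29 z (i - 1ℤ)
  x₋₁ = F-at-pred 29 z i
  x₁ = F-at-suc 29 z i
  x₂ = F-at-suc 29 z (i + 1ℤ)
  y₋₁ = trans (F-at-pred 29 Fz i) (localRule-cong 29 x₋₂ x₋₁ (refl {x = Fz i}))
  y₀ = localRule-cong 29 x₋₁ (refl {x = Fz i}) x₁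
  y₁ = trans (F-at-suc 29 Fz i) (localRule-cong 29 (refl {x = Fz i}) x₁ x₂)

-- Rule 13

rule13-constant : ∀ b → localRule 13 b b b ≡ not b
rule13-constant false = refl
rule13-constant true = refl

rule13-front : ∀ b → localRule 13 (not b) b b ≡ not (not b)
rule13-front false = refl
rule13-front true = refl

rule13-wall₀ : ∀ a → localRule 13 a false true ≡ false
rule13-wall₀ false = refl
rule13-wall₀ true = refl

rule13-wall₁ : ∀ c → localRule 13 false true c ≡ true
rule13-wall₁ false = refl
rule13-wall₁ true = refl

record Wall (z : Config) (P : ℤ) : Set where
  constructor wall
  field
    at-P : z P ≡ false
    at-P+1 : z (P + 1ℤ) ≡ true

F13-wall : ∀ {z P} → Wall z P → Wall (F 13 z) P
F13-wall {z} {P} (wall zP zP+1) = wall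
  (trans (localRule-cong 13 (refl {x = z (P - 1ℤ)}) zP zP+1) (rule13-wall₀ (z (P - 1ℤ))))
  (trans (localRule-cong 13 (trans (cong z (i+1-1≡i P)) zP) zP+1 (refl {x = z (P + 1ℤ + 1ℤ)}))
         (rule13-wall₁ (z (P + 1ℤ + 1ℤ))))

iter13-wall : ∀ {z P} → Wall z P → ∀ t → Wall (iter (F 13) t z) P
iter13-wall w zero = w
iter13-wall w (suc t) = F13-wall (iter13-wall w t)

wall-transfer : ∀ {z z′ B P} → AgreeFrom z z′ B → B ≤ P → Wall z P → Wall z′ P
wall-transfer {P = P} from B≤P (wall zP zP+1) =
  wall (trans (sym (from P B≤P)) zP) (trans (sym (from (P + 1ℤ) (ℤP.≤-trans B≤P (i≤i+1 P)))) zP+1)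

WalledAgreement : ℤ → ℤ → Config → Config → Set
WalledAgreement P R z z′ = Wall z P × Wall z′ P × Wall z R × Wall z′ R × AgreeOutside z z′ P (R + 1ℤ)

-- Cells P and R + 1 have the same successor state in z and z′ whatever their outer neighbours are.
F13-walledAgreement : ∀ {P R z z′} → WalledAgreement P R z z′ → WalledAgreement P R (F 13 z) (F 13 z′)
F13-walledAgreement {P} {R} {z} {z′} (wP , wP′ , wR , wR′ , up , from) =
  F13-wall wP , F13-wall wP′ , F13-wall wR , F13-wall wR′ , up′ , from′
  where
  up′ : AgreeUpTo (F 13 z) (F 13 z′) P
  up′ i i≤P with ≤⇒≡⊎< i≤P
  ... | inj₁ refl = trans (Wall.at-P (F13-wall wP)) (sym (Wall.at-P (F13-wall wP′)))
  ... | inj₂ i<P = localRule-cong 13 (up (i - 1ℤ) (ℤP.≤-trans (i-1≤i i) i≤P)) (up i i≤P) (up (i + 1ℤ) (<⇒+1≤ i<P))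
  from′ : AgreeFrom (F 13 z) (F 13 z′) (R + 1ℤ)
  from′ i R+1≤i with ≤⇒≡⊎< R+1≤i
  ... | inj₁ refl = trans (Wall.at-P+1 (F13-wall wR)) (sym (Wall.at-P+1 (F13-wall wR′)))
  ... | inj₂ R+1<i = localRule-cong 13 (from (i - 1ℤ) (+1≤⇒≤-1 (<⇒+1≤ R+1<i))) (from i R+1≤i)
                       (from (i + 1ℤ) (ℤP.≤-trans R+1≤i (i≤i+1 i)))

iter13-walledAgreement : ∀ {P R z z′} → WalledAgreement P R z z′ → ∀ t →
  WalledAgreement P R (iter (F 13) t z) (iter (F 13) t z′)
iter13-walledAgreement wa zero = wa
iter13-walledAgreement wa (suc t) = F13-walledAgreement (iter13-walledAgreement wa t)

record Frontier (b : Bool) (z z′ : Config) (m : ℤ) : Set where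
  constructor frontier
  field
    background : ∀ i → z i ≡ b
    at-m : z′ m ≡ not b
    beyond-m : ∀ i → m < i → z′ i ≡ b

frontier-step : ∀ {b z z′ m} → Frontier b z z′ m → Frontier (not b) (F 13 z) (F 13 z′) (m + 1ℤ)
frontier-step {b} {z} {z′} {m} (frontier bg z′m right) = frontier bg′ z′m+1 right′
  where
  bg′ : ∀ i → F 13 z i ≡ not b
  bg′ i = trans (localRule-cong 13 (bg (i - 1ℤ)) (bg i) (bg (i + 1ℤ))) (rule13-constant b)
  z′m+1 : F 13 z′ (m + 1ℤ) ≡ not (not b)
  z′m+1 = trans (localRule-cong 13 (trans (cong z′ (i+1-1≡i m)) z′m) (right (m + 1ℤ) (i<i+1 m))
                  (right (m + 1ℤ + 1ℤ) (ℤP.<-≤-trans (i<i+1 m) (i≤i+1 (m + 1ℤ)))))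
                (rule13-front b)
  right′ : ∀ i → m + 1ℤ < i → F 13 z′ i ≡ not b
  right′ i m+1<i =
    trans (localRule-cong 13 (right (i - 1ℤ) m<i-1) (right i m<i) (right (i + 1ℤ) (ℤP.<-≤-trans m<i (i≤i+1 i))))
          (rule13-constant b)
    where
    m<i-1 = +1≤⇒< (+1≤⇒≤-1 (<⇒+1≤ m+1<i))
    m<i = ℤP.<-≤-trans m<i-1 (i-1≤i i)

frontier-iter : ∀ {b z z′ m} → Frontier b z z′ m → ∀ s →
  ∃ λ (b′ : Bool) → Frontier b′ (iter (F 13) s z) (iter (F 13) s z′) (m + + s)
frontier-iter {b} {z} {z′} {m} fr zero = b , subst (Frontier b z z′) (sym (ℤP.+-identityʳ m)) fr
frontier-iter {z = z} {z′} {m} fr (suc s) with frontier-iter fr s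
... | b′ , fr′ = not b′ ,
  subst (Frontier (not b′) (iter (F 13) (suc s) z) (iter (F 13) (suc s) z′)) (i+s+1≡i+[1+s] m s) (frontier-step fr′)

frontier-wall : ∀ {z z′ m} → Frontier true z z′ m → Wall z′ m
frontier-wall {m = m} (frontier _ z′m right) = wall z′m (right (m + 1ℤ) (i<i+1 m))

frontier-differs : ∀ {b z z′ m} → Frontier b z z′ m → ¬ z m ≡ z′ m
frontier-differs {m = m} (frontier bg z′m _) = differ-at (bg m) z′m

wall-differs : ∀ {b : Bool} {z z′ : Config} {M} → (∀ i → z i ≡ b) → Wall z′ M →
  ∃ λ (d : ℤ) → d ≤ M + 1ℤ × ¬ z d ≡ z′ d
wall-differs {true} {M = M} bg (wall z′M _) = M , i≤i+1 M , differ-at (bg M) z′M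
wall-differs {false} {M = M} bg (wall _ z′M+1) = M + 1ℤ , ℤP.≤-refl , differ-at (bg (M + 1ℤ)) z′M+1

-- Once the background is 1, the frontier leaves a wall behind it that never moves.
frontier-spread : ∀ {z z′ M} → Frontier true z z′ M → ∀ w →
  Spread (iter (F 13) (suc w) z) (iter (F 13) (suc w) z′) w
frontier-spread {z} {z′} {M} fr w = d , M + + suc w , differ-d , frontier-differs (proj₂ fr′) , d+w≤M+1+w
  where
  fr′ : ∃ λ (b : Bool) → Frontier b (iter (F 13) (suc w) z) (iter (F 13) (suc w) z′) (M + + suc w)
  fr′ = frontier-iter fr (suc w)
  near : ∃ λ (d : ℤ) → d ≤ M + 1ℤ × ¬ iter (F 13) (suc w) z d ≡ iter (F 13) (suc w) z′ d
  near = wall-differs (Frontier.background (proj₂ fr′)) (iter13-wall (frontier-wall fr) (suc w))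
  d = proj₁ near
  differ-d = proj₂ (proj₂ near)
  d+w≤M+1+w : d + + w ≤ M + + suc w
  d+w≤M+1+w = subst (d + + w ≤_) (ℤP.+-assoc M 1ℤ (+ w)) (ℤP.+-monoˡ-≤ (+ w) (proj₁ (proj₂ near)))

frontier-true : ∀ {c : Bool} {z z′ : Config} {m} → Frontier c z z′ m →
  ∃ λ T → ∃ λ M → Frontier true (iter (F 13) T z) (iter (F 13) T z′) M
frontier-true {true} fr = 0 , _ , fr
frontier-true {false} fr = 1 , _ , frontier-step fr

module _ {k : ℕ} (u : Vec Bool (suc k)) {r₀ r₁ : Fin (suc k)} (u₀ : lookup u r₀ ≡ false) (u₁ : lookup u r₁ ≡ true)
  where

  per-wall-right : ∀ n → ∃ λ j → n ℕ.≤ j × Wall (per u) (+ j)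
  per-wall-right n
    with rising-edge (λ x → per u (+ x)) a≤b (trans (per-+* u r₀ n) u₀) (trans (per-+* u r₁ (suc n)) u₁)
    where
    a≤b : toℕ r₀ ℕ.+ n ℕ.* suc k ℕ.≤ toℕ r₁ ℕ.+ suc n ℕ.* suc k
    a≤b = ℕP.≤-trans (ℕP.+-monoˡ-≤ (n ℕ.* suc k) (ℕP.<⇒≤ (toℕ<n r₀))) (ℕP.m≤n+m _ (toℕ r₁))
  ... | j , a≤j , pj , pj+1 =
    j , ℕP.≤-trans (ℕP.≤-trans (ℕP.m≤m*n n (suc k)) (ℕP.m≤n+m _ (toℕ r₀))) a≤j ,
    wall pj (trans (cong (λ x → per u (+ x)) (ℕP.+-comm j 1)) pj+1)

  per-wall-left : ∃ λ j → Wall (per u) -[1+ suc j ]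
  per-wall-left with per-neg-onto u r₀ | per-neg-onto u r₁
  ... | x₀ , _ , p₀ | x₁ , x₁<d , p₁
    with rising-edge (λ x → not (per u -[1+ x ])) (ℕP.≤-trans (ℕP.<⇒≤ x₁<d) (ℕP.m≤n+m (suc k) x₀))
           (cong not (trans p₁ u₁)) (cong not (trans (per-neg-periodic u x₀) (trans p₀ u₀)))
  ... | j , _ , ¬pj , ¬pj+1 = j , wall (not-injective ¬pj+1) (not-injective ¬pj)

  SInv13-nonconstant : ∀ {n} (v : Vec Bool n) → SInv 13 u v
  SInv13-nonconstant {n} v with per-wall-left | per-wall-right n
  ... | jₗ , wₗ | jᵣ , n≤jᵣ , wᵣ =
    SInv-intro u v 13 P (R + 1ℤ) λ t → proj₂ (proj₂ (proj₂ (proj₂ (iter13-walledAgreement walled t))))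
    where
    P = -[1+ suc jₗ ]
    R = + jᵣ
    walled : WalledAgreement P R (per u) (patch u v)
    -- Left of 0, patch u v is per u by definition.
    walled = wₗ , wall (Wall.at-P wₗ) (Wall.at-P+1 wₗ) , wᵣ ,
             wall-transfer (proj₂ (patch-agreeOutside u v)) (+≤+ n≤jᵣ) wᵣ ,
             agreeOutside-mono (-≤- z≤n) (ℤP.≤-trans (+≤+ n≤jᵣ) (i≤i+1 R)) (patch-agreeOutside u v)

module _ {k n : ℕ} (u : Vec Bool (suc k)) (v : Vec Bool n) {c : Bool} (per≡c : ∀ i → per u i ≡ c) where

  patch-frontier : ∀ m → patch u v (+ m) ≡ not c → (∀ x → m ℕ.< x → ¬ patch u v (+ x) ≡ not c) →
    Frontier c (per u) (patch u v) (+ m)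
  patch-frontier m at-m beyond = frontier per≡c at-m beyond-m
    where
    beyond-m : ∀ i → + m < i → patch u v i ≡ c
    beyond-m (+ x) (+<+ m<x) = trans (¬-not (beyond x m<x)) (not-involutive c)

  ¬SInv13-constant : ∀ r → ¬ lookup v r ≡ c → ¬ SInv 13 u v
  ¬SInv13-constant r v[r]≢c
    with greatest (λ x → patch u v (+ x) ≟ not c) n (trans (patch-in u v r) (¬-not v[r]≢c))
           (λ x n≤x → not-¬ (trans (patch-out u v x n≤x) (per≡c (+ x))))
  ... | m , at-m , beyond with frontier-true (patch-frontier m at-m beyond)
  ... | T , _ , fr = ¬SInv-intro u v 13 λ w → suc w ℕ.+ T ,
          subst₂ (λ y y′ → Spread y y′ w)
            (sym (iter-+ (F 13) (suc w) T (per u))) (sym (iter-+ (F 13) (suc w) T (patch u v)))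
            (frontier-spread fr w)

  SInv13-constant : SInv 13 u v ⇔ All (_≡ c) v
  SInv13-constant = mk⇔ to λ v≡c → SInv-unperturbed u v 13 (patch-constant u v per≡c v≡c)
    where
    to : SInv 13 u v → All (_≡ c) v
    to sinv with all? (λ r → lookup v r ≟ c)
    ... | yes v≡c = lookup⁻ v≡c
    ... | no v≢c with ¬∀⟶∃¬ n _ (λ r → lookup v r ≟ c) v≢c
    ...   | r , v[r]≢c = contradiction sinv (¬SInv13-constant r v[r]≢c)

constant-or-two-valued : ∀ {m} (u : Vec Bool m) →
  (∃ λ c → ∀ r → lookup u r ≡ c) ⊎ ((∃ λ r → lookup u r ≡ false) × (∃ λ r → lookup u r ≡ true))
constant-or-two-valued {m} u with all? (λ r → lookup u r ≟ false) | all? (λ r → lookup u r ≟ true)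
... | yes u≡false | _ = inj₁ (false , u≡false)
... | no _ | yes u≡true = inj₁ (true , u≡true)
... | no u≢false | no u≢true
  with ¬∀⟶∃¬ m _ (λ r → lookup u r ≟ true) u≢true | ¬∀⟶∃¬ m _ (λ r → lookup u r ≟ false) u≢false
...   | r₀ , u[r₀]≢true | r₁ , u[r₁]≢false = inj₂ ((r₀ , ¬-not u[r₀]≢true) , (r₁ , ¬-not u[r₁]≢false))

-- Protocols

module _ {X Y : Set} {Q : X → Y → Set} where

  constant-protocol : ∀ {c} → (∀ x y → Q x y) → ∃ λ (P : Protocol X Y) → depth P ℕ.≤ c × Computes P Q
  constant-protocol Q-holds = leaf true , z≤n , λ x y → (λ _ → Q-holds x y) , (λ _ → refl)

  conjunction-protocol : ∀ {A : X → Set} {B : Y → Set} → Decidable A → Decidable B →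
    (∀ x y → Q x y ⇔ (A x × B y)) → ∃ λ (P : Protocol X Y) → depth P ℕ.≤ 2 × Computes P Q
  conjunction-protocol A? B? Q⇔A×B = protocol , ℕP.≤-refl , computes
    where
    protocol : Protocol X Y
    protocol = alice (λ x → does (A? x)) (leaf false) (bob (λ y → does (B? y)) (leaf false) (leaf true))
    computes : Computes protocol Q
    computes x y with A? x | B? y
    ... | yes a | yes b = (λ _ → Equivalence.from (Q⇔A×B x y) (a , b)) , (λ _ → refl)
    ... | yes _ | no ¬b = (λ ()) , (λ q → contradiction (proj₂ (Equivalence.to (Q⇔A×B x y) q)) ¬b)
    ... | no ¬a | _ = (λ ()) , (λ q → contradiction (proj₁ (Equivalence.to (Q⇔A×B x y) q)) ¬a)

splitDepth13 : ∀ {k} (u : Vec Bool (suc k)) i j → SplitDepth≤ 13 u i j 2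
splitDepth13 u i j with constant-or-two-valued u
... | inj₁ (c , u≡c) = conjunction-protocol (All? (_≟ c)) (All? (_≟ c)) λ x y →
  let open Equivalence (SInv13-constant u (x ++ y) (λ _ → u≡c _)) in
  mk⇔ (λ sinv → ++⁻ x (to sinv)) (λ (all-x , all-y) → from (++⁺ all-x all-y))
... | inj₂ ((_ , u₀) , (_ , u₁)) = constant-protocol λ x y → SInv13-nonconstant u u₀ u₁ (x ++ y)

splitDepth29 : ∀ {k} (u : Vec Bool (suc k)) i j → SplitDepth≤ 29 u i j 0
splitDepth29 u i j = constant-protocol λ x y → SInv-of-cube u (x ++ y) 29 F29-cube

proposition6 : ∀ (N : ℕ) → N ≡ 13 ⊎ N ≡ 29 →
    ∀ (k : ℕ) (u : Vec Bool (suc k)) →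
    ∃ λ (c : ℕ) → ∃ λ (n₀ : ℕ) → ∀ (i j : ℕ) → n₀ ℕ.≤ i ℕ.+ j →
      SplitDepth≤ N u i j c
proposition6 .13 (inj₁ refl) k u = 2 , 0 , λ i j _ → splitDepth13 u i j
proposition6 .29 (inj₂ refl) k u = 0 , 0 , λ i j _ → splitDepth29 u i j
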